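{- Let $l\ge3$, $d\ge1$. (i) A subset $X\subseteq V$ is a subsystem of $M(l,d)$ if and only if $L\subseteq X$ or $|L\cap X|\le1$. (ii) A subset $X\subseteq V$ is open in $M(l,d)$ if and only if $X\subseteq D$ or $|L\cap X|\ge l-1$.
   Context: For $l\ge3$, $d\ge1$, let $V=\{1,\dots,l+d\}$, $L=\{1,\dots,l\}$, $D=\{l+1,\dots,l+d\}$, and let $M(l,d)$ be the pairwise balanced design on $V$ whose blocks are $L$ together with all $\{i,j\}$ with $l+1\le j\le l+d$, $1\le i<j$. A subsystem is a set $F\subseteq V$ such that for all distinct $x,y\in F$ the unique block containing $x,y$ lies in $F$; a set is open if its complement in $V$ is a subsystem. -}

module Defs where

open import Data.Nat using (ℕ; _+_; _<_; _≤_)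
open import Data.Fin using (Fin; toℕ)
open import Data.Fin.Subset using (Subset; _∈_; _∉_; _⊆_; ∁; _∩_; ∣_∣)
open import Data.Fin.Subset.Properties using ()
open import Data.Vec.Functional using ()
open import Data.Vec using (tabulate)
open import Data.Bool using (Bool; true; false)
open import Relation.Nullary using (¬_; does)
open import Relation.Binary.PropositionalEquality using (_≡_)
open import Data.Product using (_×_; ∃)
open import Data.Sum using (_⊎_)
open import Data.Nat.Properties using (_<?_)

-- Points of V = {1,…,l+d} are encoded 0-based as Fin (l + d):
-- the point i+1 of the paper is the element with toℕ = i.
-- Hence L = {x | toℕ x < l} and D = {x | l ≤ toℕ x}.

Lset : (l d : ℕ) → Subset (l + d)
Lset l d = tabulate (λ x → does (toℕ x <? l))

Dset : (l d : ℕ) → Subset (l + d)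
Dset l d = ∁ (Lset l d)

IsBlock : (l d : ℕ) → Subset (l + d) → Set
IsBlock l d B =
  B ≡ Lset l d ⊎
  ∃ λ (i : Fin (l + d)) → ∃ λ (j : Fin (l + d)) →
    l ≤ toℕ j × toℕ i < toℕ j ×
    (∀ z → z ∈ B → (z ≡ i ⊎ z ≡ j)) × i ∈ B × j ∈ B

-- Subsystem: for distinct x,y ∈ F, the (unique) block containing x,y lies in F.
-- (Stated as: every block containing x and y is contained in F; in a PBD that
-- block is unique.)
IsSubsystem : (l d : ℕ) → Subset (l + d) → Set
IsSubsystem l d F =
  ∀ (x y : Fin (l + d)) → x ∈ F → y ∈ F → ¬ (x ≡ y) →
    ∀ (B : Subset (l + d)) → IsBlock l d B → x ∈ B → y ∈ B → B ⊆ F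

IsOpen : (l d : ℕ) → Subset (l + d) → Set
IsOpen l d X = IsSubsystem l d (∁ X)

module Submission where

-- A two-point block {i,j} that contains two distinct points x, y of X
-- is exactly {x,y}, hence lies in X automatically.  So the only block that
-- can break closure is the long block L, and
--     X is a subsystem  ⇔  any two distinct points of L ∩ X force L ⊆ X.
-- For arbitrary subsets p, q of a finite set, "two distinct points of p ∩ q
-- force p ⊆ q" is equivalent to "p ⊆ q or ∣p ∩ q∣ ≤ 1"; this gives (i).
-- Part (ii) is (i) applied to the complement ∁ X: the condition L ⊆ ∁ X is
-- X ⊆ ∁ L = D, and since ∣L ∩ X∣ + ∣L ∩ ∁ X∣ = ∣L∣ = l, the condition
-- ∣L ∩ ∁ X∣ ≤ 1 is l ∸ 1 ≤ ∣L ∩ X∣.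

open import Defs
open import Data.Nat using (ℕ; suc; _+_; _∸_; _≤_; z≤n; s≤s)
open import Data.Nat.Properties
  using (≤-trans; ≤-reflexive; +-comm; +-suc; +-monoʳ-≤; +-cancelˡ-≤; m≤n+m∸n; m≤n+o⇒m∸n≤o)
open import Data.Fin using (Fin)
open import Data.Fin.Properties using (_≟_; 0≢1+n; suc-injective)
open import Data.Fin.Subset using (Subset; _∈_; _⊆_; ∁; _∩_; ∣_∣; _∉_; ⊥; inside; outside)
open import Data.Fin.Subset.Properties
  using (_⊆?_; x∈p∩q⁺; x∈p∩q⁻; x∉p⇒x∈∁p; x∈∁p⇒x∉p; Empty-unique; ∣⊥∣≡0)
open import Data.Vec using ([]; _∷_; here; there)
open import Data.Product using (_×_; _,_)
open import Data.Sum using (_⊎_; inj₁; inj₂)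
open import Data.Sum.Function.Propositional using (_⊎-⇔_)
open import Function.Bundles using (_⇔_; mk⇔; Equivalence)
open import Function.Properties.Equivalence using () renaming (trans to ⇔-trans)
open import Relation.Nullary using (yes; no; contradiction)
open import Relation.Binary.PropositionalEquality using (_≡_; _≢_; refl; sym; trans; cong; subst)

AtMostOne : ∀ {n} → Subset n → Set
AtMostOne p = ∀ {x y} → x ∈ p → y ∈ p → x ≡ y

∣p∣≤0⇒∉ : ∀ {n} {p : Subset n} {x : Fin n} → ∣ p ∣ ≤ 0 → x ∉ p
∣p∣≤0⇒∉ {p = outside ∷ p} ∣p∣≤0 (there x∈p) = ∣p∣≤0⇒∉ ∣p∣≤0 x∈p
∣p∣≤0⇒∉ {p = inside ∷ p} () _

∣p∣≤1⇔AtMostOne : ∀ {n} (p : Subset n) → ∣ p ∣ ≤ 1 ⇔ AtMostOne p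
∣p∣≤1⇔AtMostOne p = mk⇔ (to p) (from p)
  where
  to : ∀ {n} (p : Subset n) → ∣ p ∣ ≤ 1 → AtMostOne p
  to (outside ∷ p) ∣p∣≤1 (there x∈p) (there y∈p) = cong Fin.suc (to p ∣p∣≤1 x∈p y∈p)
  to (inside ∷ p) _ here here = refl
  to (inside ∷ p) (s≤s ∣p∣≤0) here (there y∈p) = contradiction y∈p (∣p∣≤0⇒∉ ∣p∣≤0)
  to (inside ∷ p) (s≤s ∣p∣≤0) (there x∈p) _ = contradiction x∈p (∣p∣≤0⇒∉ ∣p∣≤0)

  from : ∀ {n} (p : Subset n) → AtMostOne p → ∣ p ∣ ≤ 1
  from [] _ = z≤n
  from (outside ∷ p) unique = from p (λ x∈p y∈p → suc-injective (unique (there x∈p) (there y∈p)))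
  from {suc n} (inside ∷ p) unique = s≤s (≤-reflexive ∣p∣≡0)
    where
    ∣p∣≡0 : ∣ p ∣ ≡ 0
    ∣p∣≡0 = trans (cong ∣_∣ (Empty-unique λ (y , y∈p) → 0≢1+n (unique here (there y∈p)))) (∣⊥∣≡0 n)

PairsForce : ∀ {n} → Subset n → Subset n → Set
PairsForce p q = ∀ {x y} → x ∈ p ∩ q → y ∈ p ∩ q → x ≢ y → p ⊆ q

-- Since inclusion and equality of points are decidable, this happens exactly
-- when p ⊆ q already holds or p ∩ q has at most one point.
PairsForce⇔ : ∀ {n} (p q : Subset n) → PairsForce p q ⇔ (p ⊆ q ⊎ ∣ p ∩ q ∣ ≤ 1)
PairsForce⇔ p q = mk⇔ to from
  where
  atMostOne : ∣ p ∩ q ∣ ≤ 1 ⇔ AtMostOne (p ∩ q)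
  atMostOne = ∣p∣≤1⇔AtMostOne (p ∩ q)

  to : PairsForce p q → p ⊆ q ⊎ ∣ p ∩ q ∣ ≤ 1
  to force with p ⊆? q
  ... | yes p⊆q = inj₁ p⊆q
  ... | no p⊈q = inj₂ (Equivalence.from atMostOne unique)
    where
    unique : AtMostOne (p ∩ q)
    unique {x} {y} x∈p∩q y∈p∩q with x ≟ y
    ... | yes x≡y = x≡y
    ... | no x≢y = contradiction (λ {z} → force x∈p∩q y∈p∩q x≢y {z}) p⊈q

  from : p ⊆ q ⊎ ∣ p ∩ q ∣ ≤ 1 → PairsForce p q
  from (inj₁ p⊆q) _ _ _ = p⊆q
  from (inj₂ ∣p∩q∣≤1) x∈p∩q y∈p∩q x≢y =
    contradiction (Equivalence.to atMostOne ∣p∩q∣≤1 x∈p∩q y∈p∩q) x≢y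

⊆∁-swap : ∀ {n} {p q : Subset n} → p ⊆ ∁ q ⇔ q ⊆ ∁ p
⊆∁-swap = mk⇔ swap swap
  where
  swap : ∀ {n} {p q : Subset n} → p ⊆ ∁ q → q ⊆ ∁ p
  swap p⊆∁q x∈q = x∉p⇒x∈∁p λ x∈p → x∈∁p⇒x∉p (p⊆∁q x∈p) x∈q

∣p∩q∣+∣p∩∁q∣≡∣p∣ : ∀ {n} (p q : Subset n) → ∣ p ∩ q ∣ + ∣ p ∩ ∁ q ∣ ≡ ∣ p ∣
∣p∩q∣+∣p∩∁q∣≡∣p∣ [] [] = refl
∣p∩q∣+∣p∩∁q∣≡∣p∣ (outside ∷ p) (_ ∷ q) = ∣p∩q∣+∣p∩∁q∣≡∣p∣ p q
∣p∩q∣+∣p∩∁q∣≡∣p∣ (inside ∷ p) (inside ∷ q) = cong suc (∣p∩q∣+∣p∩∁q∣≡∣p∣ p q)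
∣p∩q∣+∣p∩∁q∣≡∣p∣ (inside ∷ p) (outside ∷ q) =
  trans (+-suc ∣ p ∩ q ∣ ∣ p ∩ ∁ q ∣) (cong suc (∣p∩q∣+∣p∩∁q∣≡∣p∣ p q))

-- Arithmetic translation of "the other part has at most one point".
≤1⇔∸1≤ : ∀ a b → b ≤ 1 ⇔ a + b ∸ 1 ≤ a
≤1⇔∸1≤ a b = mk⇔ to from
  where
  to : b ≤ 1 → a + b ∸ 1 ≤ a
  to b≤1 = m≤n+o⇒m∸n≤o (a + b) 1 (≤-trans (+-monoʳ-≤ a b≤1) (≤-reflexive (+-comm a 1)))

  from : a + b ∸ 1 ≤ a → b ≤ 1
  from le = +-cancelˡ-≤ a b 1
    (≤-trans (m≤n+m∸n (a + b) 1) (≤-trans (+-monoʳ-≤ 1 le) (≤-reflexive (+-comm 1 a))))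

-- A set covered by {i, j} that contains two distinct points x, y is covered
-- by {x, y}: a two-point block is determined by any two of its points.
twoPoint : ∀ {n} {B : Subset n} {i j x y : Fin n} →
  (∀ z → z ∈ B → z ≡ i ⊎ z ≡ j) → x ∈ B → y ∈ B → x ≢ y →
  ∀ {z} → z ∈ B → z ≡ x ⊎ z ≡ y
twoPoint B⊆ij x∈B y∈B x≢y {z} z∈B with B⊆ij z z∈B | B⊆ij _ x∈B | B⊆ij _ y∈B
... | inj₁ z≡i | inj₁ x≡i | _        = inj₁ (trans z≡i (sym x≡i))
... | inj₁ z≡i | inj₂ _   | inj₁ y≡i = inj₂ (trans z≡i (sym y≡i))
... | inj₁ _   | inj₂ x≡j | inj₂ y≡j = contradiction (trans x≡j (sym y≡j)) x≢y
... | inj₂ z≡j | inj₂ x≡j | _        = inj₁ (trans z≡j (sym x≡j))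
... | inj₂ z≡j | inj₁ _   | inj₂ y≡j = inj₂ (trans z≡j (sym y≡j))
... | inj₂ _   | inj₁ x≡i | inj₁ y≡i = contradiction (trans x≡i (sym y≡i)) x≢y

-- Only the long block L can break closure, so X is a subsystem exactly when
-- two distinct points of L ∩ X force L ⊆ X.
subsystem⇔PairsForce : ∀ l d (X : Subset (l + d)) → IsSubsystem l d X ⇔ PairsForce (Lset l d) X
subsystem⇔PairsForce l d X = mk⇔ to from
  where
  L : Subset (l + d)
  L = Lset l d

  to : IsSubsystem l d X → PairsForce L X
  to closed x∈L∩X y∈L∩X x≢y with x∈p∩q⁻ L X x∈L∩X | x∈p∩q⁻ L X y∈L∩X
  ... | x∈L , x∈X | y∈L , y∈X = closed _ _ x∈X y∈X x≢y L (inj₁ refl) x∈L y∈L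

  from : PairsForce L X → IsSubsystem l d X
  from force x y x∈X y∈X x≢y .L (inj₁ refl) x∈L y∈L =
    force (x∈p∩q⁺ (x∈L , x∈X)) (x∈p∩q⁺ (y∈L , y∈X)) x≢y
  from force x y x∈X y∈X x≢y B (inj₂ (_ , _ , _ , _ , B⊆ij , _ , _)) x∈B y∈B z∈B
    with twoPoint B⊆ij x∈B y∈B x≢y z∈B
  ... | inj₁ refl = x∈X
  ... | inj₂ refl = y∈X

Lset-zero : ∀ d → Lset 0 d ≡ ⊥
Lset-zero 0 = refl
Lset-zero (suc d) = cong (outside ∷_) (Lset-zero d)

-- L has exactly l points; the step is by computation, since L for l + 1 is
-- inside ∷ (L for l) definitionally.
∣Lset∣ : ∀ l d → ∣ Lset l d ∣ ≡ l
∣Lset∣ 0 d = trans (cong ∣_∣ (Lset-zero d)) (∣⊥∣≡0 d)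
∣Lset∣ (suc l) d = cong suc (∣Lset∣ l d)

subsystem⇔ : ∀ l d (X : Subset (l + d)) →
  IsSubsystem l d X ⇔ (Lset l d ⊆ X ⊎ ∣ Lset l d ∩ X ∣ ≤ 1)
subsystem⇔ l d X = ⇔-trans (subsystem⇔PairsForce l d X) (PairsForce⇔ (Lset l d) X)

-- Part (ii): part (i) for ∁ X, with L ⊆ ∁ X read as X ⊆ D and ∣L ∩ ∁ X∣ ≤ 1
-- read through ∣L ∩ X∣ + ∣L ∩ ∁ X∣ = l.
open⇔ : ∀ l d (X : Subset (l + d)) →
  IsOpen l d X ⇔ (X ⊆ Dset l d ⊎ l ∸ 1 ≤ ∣ Lset l d ∩ X ∣)
open⇔ l d X = ⇔-trans (subsystem⇔ l d (∁ X)) (⊆∁-swap ⊎-⇔ complementSmall)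
  where
  L : Subset (l + d)
  L = Lset l d

  ∣L∩X∣+∣L∩∁X∣≡l : ∣ L ∩ X ∣ + ∣ L ∩ ∁ X ∣ ≡ l
  ∣L∩X∣+∣L∩∁X∣≡l = trans (∣p∩q∣+∣p∩∁q∣≡∣p∣ L X) (∣Lset∣ l d)

  complementSmall : ∣ L ∩ ∁ X ∣ ≤ 1 ⇔ l ∸ 1 ≤ ∣ L ∩ X ∣
  complementSmall = subst (λ k → ∣ L ∩ ∁ X ∣ ≤ 1 ⇔ k ∸ 1 ≤ ∣ L ∩ X ∣) ∣L∩X∣+∣L∩∁X∣≡l
    (≤1⇔∸1≤ ∣ L ∩ X ∣ ∣ L ∩ ∁ X ∣)

-- Lemma 9.1.
lemma9p1 : (l d : ℕ) → 3 ≤ l → 1 ≤ d →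
    (∀ (X : Subset (l + d)) →
       IsSubsystem l d X ⇔ (Lset l d ⊆ X ⊎ ∣ Lset l d ∩ X ∣ ≤ 1))
    ×
    (∀ (X : Subset (l + d)) →
       IsOpen l d X ⇔ (X ⊆ Dset l d ⊎ l ∸ 1 ≤ ∣ Lset l d ∩ X ∣))
lemma9p1 l d _ _ = subsystem⇔ l d , open⇔ l d
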